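{- For fixed $\alpha$, the function $f_{\sf T}(n,\alpha)$ is strictly increasing in $n$: for all integers $1\le\alpha\le n-1$, $f_{\sf T}(n-1,\alpha)<f_{\sf T}(n,\alpha)$.
   Context: The Fibonacci index $F(G)$ of a graph is the number of its stable sets, including the empty set. For $1\le\alpha\le n$, the Turán graph $T_{n,\alpha}$ is the disjoint union of $\alpha$ cliques with orders summing to $n$ and pairwise differing by at most one, and $f_{\sf T}(n,\alpha)=F(T_{n,\alpha})$. -}

module Defs where

open import Data.Nat using (ℕ; zero; suc; NonZero)
open import Data.Nat.DivMod using (_%_)
open import Data.Bool using (Bool; true; false; _∧_; not)
open import Data.Fin using (Fin; toℕ; _≟_)
open import Data.Vec using (Vec; []; _∷_; lookup)
open import Data.List using (List; []; _∷_; map; _++_; length; filter; allFin; foldr)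
open import Data.Bool.Properties using (T?)
open import Relation.Nullary.Decidable using (does; ⌊_⌋)
import Data.Nat as ℕ

-- A (simple) graph on vertex set Fin n, given by a Bool-valued adjacency
-- relation (for the Turán graph below it is symmetric and irreflexive).
Graph : ℕ → Set
Graph n = Fin n → Fin n → Bool

Subset : ℕ → Set
Subset n = Vec Bool n

allSubsets : (n : ℕ) → List (Subset n)
allSubsets zero = [] ∷ []
allSubsets (suc n) = map (true ∷_) (allSubsets n) ++ map (false ∷_) (allSubsets n)

allᵇ : ∀ {A : Set} → (A → Bool) → List A → Bool
allᵇ p = foldr (λ x b → p x ∧ b) true

isStable : ∀ {n} → Graph n → Subset n → Bool
isStable {n} G S =
  allᵇ (λ i → allᵇ (λ j → not (lookup S i ∧ lookup S j ∧ G i j)) (allFin n)) (allFin n)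

-- Fibonacci index: number of stable sets (the empty set included).
F : ∀ {n} → Graph n → ℕ
F {n} G = length (filter (λ S → T? (isStable G S)) (allSubsets n))

-- Turán graph T_{n,α}: vertex i lies in clique number (i mod α); distinct
-- vertices are adjacent iff they lie in the same clique.  This gives α
-- disjoint cliques with orders summing to n, pairwise differing by ≤ 1.
turán : (n α : ℕ) → .{{_ : NonZero α}} → Graph n
turán n α i j = not ⌊ i ≟ j ⌋ ∧ ⌊ (toℕ i % α) ℕ.≟ (toℕ j % α) ⌋

fT : (n α : ℕ) → .{{_ : NonZero α}} → ℕ
fT n α = F (turán n α)

module Submission where

-- Idea.  Deleting vertex 0 of T_{m+1,α} leaves (up to relabelling i ↦ i+1)
-- a graph with no more edges than T_{m,α}: two shifted vertices in a common
-- clique were already in a common clique.  So every stable set S of T_{m,α}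
-- gives the stable set {i+1 | i ∈ S} of T_{m+1,α} avoiding 0, while the
-- singleton {0} is a further stable set of T_{m+1,α} that contains 0.  Hence
-- F(T_{m,α}) < F(T_{m+1,α}).

open import Defs
import Data.Nat as ℕ
open import Data.Nat using (ℕ; zero; suc; _+_; _≤_; _<_; NonZero; z≤n; s≤s)
open import Data.Nat.Properties using (+-mono-≤; +-suc; m≤n⇒m≤1+n)
open import Data.Nat.DivMod using (_%_; [m+n]%n≡m%n; %-distribˡ-+)
open import Data.Bool using (Bool; true; false; _∧_; not; T)
open import Data.Bool.Properties using (T?; T-∧)
open import Data.Unit using (tt)
open import Data.Empty using (⊥-elim)
open import Data.Fin using (Fin; toℕ; _≟_)
import Data.Fin as Fin
open import Data.Vec using (_∷_; lookup; replicate)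
open import Data.Vec.Properties using (lookup-replicate)
open import Data.List using (List; []; _∷_; map; _++_; length; filter; allFin)
open import Data.List.Properties using (length-++; filter-++; filter-some)
open import Data.List.Membership.Propositional using (_∈_; lose)
open import Data.List.Membership.Propositional.Properties using (∈-allFin; ∈-++⁺ʳ; ∈-map⁺)
open import Data.List.Relation.Unary.All as All using (All; []; _∷_)
open import Data.List.Relation.Unary.Any using (here)
import Data.List.Relation.Unary.Any.Properties as Any
open import Data.Product using (_×_; _,_; proj₁)
open import Function using (_∘_; _⇔_; mk⇔; Equivalence)
open import Relation.Nullary using (¬_; Dec; yes; no; contradiction)
open import Relation.Nullary.Decidable using (⌊_⌋; toWitness; fromWitness; toWitnessFalse; fromWitnessFalse)
open import Relation.Unary using (Decidable)
open import Relation.Binary.PropositionalEquality using (_≡_; _≢_; refl; cong; sym; subst; module ≡-Reasoning)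

open Equivalence using (to; from)

T-allᵇ : ∀ {A : Set} (p : A → Bool) (xs : List A) → T (allᵇ p xs) ⇔ All (T ∘ p) xs
T-allᵇ p []       = mk⇔ (λ _ → []) (λ _ → tt)
T-allᵇ p (x ∷ xs) = mk⇔
  (λ h → let (px , rest) = to T-∧ h in px ∷ to (T-allᵇ p xs) rest)
  (λ { (px ∷ rest) → from T-∧ (px , from (T-allᵇ p xs) rest) })

T-not-∧∧ : ∀ a b c → T (not (a ∧ b ∧ c)) ⇔ (T a → T b → ¬ T c)
T-not-∧∧ false b     c     = mk⇔ (λ _ ()) (λ _ → tt)
T-not-∧∧ true  false c     = mk⇔ (λ _ _ ()) (λ _ → tt)
T-not-∧∧ true  true  false = mk⇔ (λ _ _ _ ()) (λ _ → tt)
T-not-∧∧ true  true  true  = mk⇔ (λ ()) (λ h → h tt tt tt)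

IsStable : ∀ {n} → Graph n → Subset n → Set
IsStable G S = ∀ i j → T (lookup S i) → T (lookup S j) → ¬ T (G i j)

isStable-sound : ∀ {n} (G : Graph n) (S : Subset n) → T (isStable G S) → IsStable G S
isStable-sound {n} G S stable i j =
  to (T-not-∧∧ (lookup S i) (lookup S j) (G i j))
     (All.lookup (to (T-allᵇ _ (allFin n)) row) (∈-allFin j))
  where
  row : T (allᵇ (λ j → not (lookup S i ∧ lookup S j ∧ G i j)) (allFin n))
  row = All.lookup (to (T-allᵇ _ (allFin n)) stable) (∈-allFin i)

isStable-complete : ∀ {n} (G : Graph n) (S : Subset n) → IsStable G S → T (isStable G S)
isStable-complete {n} G S stable =
  from (T-allᵇ _ (allFin n)) (All.tabulate λ {i} _ →
    from (T-allᵇ _ (allFin n)) (All.tabulate λ {j} _ →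
      from (T-not-∧∧ (lookup S i) (lookup S j) (G i j)) (stable i j)))

length-filter-map-≤ : ∀ {A B : Set} {P : A → Set} {Q : B → Set}
  (P? : Decidable P) (Q? : Decidable Q) (f : A → B) →
  (∀ x → P x → Q (f x)) → ∀ xs → length (filter P? xs) ≤ length (filter Q? (map f xs))
length-filter-map-≤ P? Q? f P⇒Q [] = z≤n
length-filter-map-≤ P? Q? f P⇒Q (x ∷ xs) with P? x | Q? (f x)
... | yes _  | yes _  = s≤s (length-filter-map-≤ P? Q? f P⇒Q xs)
... | yes px | no ¬qx = contradiction (P⇒Q x px) ¬qx
... | no _   | yes _  = m≤n⇒m≤1+n (length-filter-map-≤ P? Q? f P⇒Q xs)
... | no _   | no _   = length-filter-map-≤ P? Q? f P⇒Q xs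

stable? : ∀ {n} (G : Graph n) → Decidable (T ∘ isStable G)
stable? G S = T? (isStable G S)

F-split : ∀ {m} (H : Graph (suc m)) →
  F H ≡ length (filter (stable? H) (map (true ∷_) (allSubsets m)))
      + length (filter (stable? H) (map (false ∷_) (allSubsets m)))
F-split {m} H = begin
  length (filter (stable? H) (with0 ++ without0))
    ≡⟨ cong length (filter-++ (stable? H) with0 without0) ⟩
  length (filter (stable? H) with0 ++ filter (stable? H) without0)
    ≡⟨ length-++ (filter (stable? H) with0) ⟩
  length (filter (stable? H) with0) + length (filter (stable? H) without0) ∎
  where
  open ≡-Reasoning
  with0 without0 : List (Subset (suc m))
  with0    = map (true ∷_) (allSubsets m)
  without0 = map (false ∷_) (allSubsets m)

RestrictsInto : ∀ {m} → Graph (suc m) → Graph m → Set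
RestrictsInto H G = ∀ i j → T (H (Fin.suc i) (Fin.suc j)) → T (G i j)

stable-shift : ∀ {m} (G : Graph m) (H : Graph (suc m)) → RestrictsInto H G →
  ∀ S → IsStable G S → IsStable H (false ∷ S)
stable-shift G H H⊆G S stable (Fin.suc i) (Fin.suc j) si sj adj = stable i j si sj (H⊆G i j adj)

unchosen : ∀ {m} (i : Fin m) → ¬ T (lookup (replicate m false) i)
unchosen i chosen = subst T (lookup-replicate i false) chosen

stable-singleton : ∀ {m} (H : Graph (suc m)) → ¬ T (H Fin.zero Fin.zero) →
  IsStable H (true ∷ replicate m false)
stable-singleton H loopless Fin.zero    Fin.zero    _  _  = loopless
stable-singleton H loopless Fin.zero    (Fin.suc j) _  sj = ⊥-elim (unchosen j sj)
stable-singleton H loopless (Fin.suc i) _           si _  = ⊥-elim (unchosen i si)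

empty∈allSubsets : ∀ n → replicate n false ∈ allSubsets n
empty∈allSubsets zero    = here refl
empty∈allSubsets (suc n) =
  ∈-++⁺ʳ (map (true ∷_) (allSubsets n)) (∈-map⁺ (false ∷_) (empty∈allSubsets n))

-- Vertex-extension lemma: stable sets of G embed into those of H avoiding 0,
-- and {0} is one more stable set of H, so F G < F H.
F-extend : ∀ {m} (G : Graph m) (H : Graph (suc m)) →
  RestrictsInto H G → ¬ T (H Fin.zero Fin.zero) → F G < F H
F-extend {m} G H H⊆G loopless =
  subst (F G <_) (sym (F-split H)) (+-mono-≤ containing0 avoiding0)
  where
  containing0 : 1 ≤ length (filter (stable? H) (map (true ∷_) (allSubsets m)))
  containing0 = filter-some (stable? H) (Any.map⁺ (lose {P = T ∘ isStable H ∘ (true ∷_)}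
    (empty∈allSubsets m)
    (isStable-complete H (true ∷ replicate m false) (stable-singleton H loopless))))

  avoiding0 : F G ≤ length (filter (stable? H) (map (false ∷_) (allSubsets m)))
  avoiding0 = length-filter-map-≤ (stable? G) (stable? H) (false ∷_)
    (λ S s → isStable-complete H (false ∷ S) (stable-shift G H H⊆G S (isStable-sound G S s)))
    (allSubsets m)

%-cancel-suc : ∀ x y d .{{_ : NonZero d}} → suc x % d ≡ suc y % d → x % d ≡ y % d
%-cancel-suc x y d@(suc a) same = begin
  x % d                         ≡⟨ predecessor x ⟩
  (suc x % d + a % d) % d       ≡⟨ cong (λ r → (r + a % d) % d) same ⟩
  (suc y % d + a % d) % d       ≡⟨ predecessor y ⟨
  y % d                         ∎
  where
  open ≡-Reasoning
  -- z ≡ (1+z) + (d-1) (mod d)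
  predecessor : ∀ z → z % d ≡ (suc z % d + a % d) % d
  predecessor z = begin
    z % d             ≡⟨ [m+n]%n≡m%n z d ⟨
    (z + d) % d       ≡⟨ cong (_% d) (+-suc z a) ⟩
    (suc z + a) % d   ≡⟨ %-distribˡ-+ (suc z) a d ⟩
    (suc z % d + a % d) % d ∎

turán-adjacent : ∀ n α .{{_ : NonZero α}} (i j : Fin n) →
  T (turán n α i j) ⇔ (i ≢ j × toℕ i % α ≡ toℕ j % α)
turán-adjacent n α i j = mk⇔
  (λ adj → let (distinct , same) = to (T-∧ {not ⌊ i ≟ j ⌋}) adj in
    toWitnessFalse {a? = i ≟ j} distinct , toWitness {a? = residue≟} same)
  (λ (distinct , same) →
    from (T-∧ {not ⌊ i ≟ j ⌋}) (fromWitnessFalse distinct , fromWitness same))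
  where
  residue≟ : Dec (toℕ i % α ≡ toℕ j % α)
  residue≟ = toℕ i % α ℕ.≟ toℕ j % α

turán-restricts : ∀ m α .{{_ : NonZero α}} → RestrictsInto (turán (suc m) α) (turán m α)
turán-restricts m α i j adj =
  let (distinct , same) = to (turán-adjacent (suc m) α (Fin.suc i) (Fin.suc j)) adj in
  from (turán-adjacent m α i j)
    (distinct ∘ cong Fin.suc , %-cancel-suc (toℕ i) (toℕ j) α same)

turán-loopless : ∀ n α .{{_ : NonZero α}} (i : Fin n) → ¬ T (turán n α i i)
turán-loopless n α i loop = proj₁ (to (turán-adjacent n α i i) loop) refl

corollary11 : (m α : ℕ) → .{{_ : NonZero α}} → α ≤ m → fT m α < fT (suc m) α
corollary11 m α _ =
  F-extend (turán m α) (turán (suc m) α) (turán-restricts m α) (turán-loopless (suc m) α Fin.zero)
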